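{- Let $p$ be a prime, let $K$ be a field of characteristic $p$ (a field extension of $\mathbb{F}_p$), let $a_1,\dots,a_l\in K$, let $k$ be a positive integer and $D=p^{\lfloor\log_p(k)\rfloor+1}$. For integers $m_1,\dots,m_l$ define $$\Lambda^{(p)}_{a_1,\dots,a_l}(k,m_1,\dots,m_l)=\Lambda_{a_1,\dots,a_l}(k,m_1^{+},\dots,m_l^{+})\in K,$$ where $m_j^{+}=m_j$ if $m_j>0$ and $m_j^{+}=m_j+\left(\left\lfloor\frac{ -m_j}{D}\right\rfloor+1\right)D$ if $m_j\le 0$. Then $\Lambda^{(p)}_{a_1,\dots,a_l}(k,m_1,\dots,m_l)$ is periodic in each of the variables $m_1,\dots,m_l$ with period $D$.
   Context: For $a_1,a_2,\dots\in K$, an integer $k$ and nonnegative integers $m_i$: $\Lambda_{a_1}(k,m)=a_1^k\binom{m}{k}$ (taken to be $0$ if $k<0$ or $k>m$; integer binomial coefficients are mapped into $K$, i.e. reduced mod $p$; $a^0=1$), and recursively $\Lambda_{a_1,\dots,a_{l+1}}(k,m_1,\dots,m_{l+1})=\sum_{j=0}^{m_{l+1}}\binom{m_{l+1}}{j}a_{l+1}^j\Lambda_{a_1,\dots,a_l}(k-j,m_1,\dots,m_l)$. -}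

module Defs where

open import Level using (Level; _⊔_) renaming (suc to lsuc)
open import Algebra.Bundles using (CommutativeRing)
import Algebra.Bundles
open import Data.Nat as ℕ using (ℕ; zero; suc; NonZero; _≤?_)
open import Data.Nat.Combinatorics using (_C_)
open import Data.Integer as ℤ using (ℤ; +_; -[1+_]; ∣_∣; _/ℕ_)
open import Data.Fin using (Fin; fromℕ; inject₁)
open import Data.Product using (∃)
open import Relation.Nullary using (¬_; yes; no)

record Field c ℓ : Set (lsuc (c ⊔ ℓ)) where
  field
    commutativeRing : CommutativeRing c ℓ
  open CommutativeRing commutativeRing public
  field
    0≉1     : ¬ (0# ≈ 1#)
    inverse : ∀ x → ¬ (x ≈ 0#) → ∃ λ y → (x * y) ≈ 1#
  open import Algebra.Definitions.RawSemiring (Algebra.Bundles.Semiring.rawSemiring semiring) public using (_×_; _^_)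

module _ {c ℓ} (R : CommutativeRing c ℓ) where
  open CommutativeRing R
  open import Algebra.Definitions.RawSemiring (Algebra.Bundles.Semiring.rawSemiring semiring) using (_×_; _^_)

  sumUpTo : ℕ → (ℕ → Carrier) → Carrier
  sumUpTo zero    f = f 0
  sumUpTo (suc n) f = sumUpTo n f + f (suc n)

  binom : ℕ → ℕ → Carrier
  binom m j = (m C j) × 1#

  Λ₁ : Carrier → ℤ → ℕ → Carrier
  Λ₁ a (+ n) m with n ≤? m
  ... | yes _ = (a ^ n) * binom m n
  ... | no  _ = 0#
  Λ₁ a -[1+ _ ] m = 0#

  -- Λ_{a_1,…,a_{l+1}}(k, m_1,…,m_{l+1}) (l+1 variables, indexed by Fin (suc l));
  -- recursion on the last variable as in the paper.
  Λ : (l : ℕ) → (Fin (suc l) → Carrier) → ℤ → (Fin (suc l) → ℕ) → Carrier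
  Λ zero    a k m = Λ₁ (a Fin.zero) k (m Fin.zero)
    where import Data.Fin as Fin
  Λ (suc l) a k m =
    sumUpTo (m (fromℕ (suc l))) λ j →
      binom (m (fromℕ (suc l))) j * (a (fromℕ (suc l)) ^ j)
        * Λ l (λ i → a (inject₁ i)) (k ℤ.- + j) (λ i → m (inject₁ i))

plusPart : (D : ℕ) → .{{NonZero D}} → ℤ → ℕ
plusPart D (+ suc n) = suc n
plusPart D (+ zero)  = ∣ + 0 ℤ.+ ((ℤ.- + 0) /ℕ D ℤ.+ + 1) ℤ.* + D ∣
plusPart D -[1+ n ]  = ∣ -[1+ n ] ℤ.+ ((ℤ.- -[1+ n ]) /ℕ D ℤ.+ + 1) ℤ.* + D ∣

Λp : ∀ {c ℓ} (R : CommutativeRing c ℓ) (D : ℕ) → .{{NonZero D}} → (l : ℕ)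
   → (Fin (suc l) → CommutativeRing.Carrier R) → ℤ → (Fin (suc l) → ℤ)
   → CommutativeRing.Carrier R
Λp R D l a k m = Λ R l a k (λ i → plusPart D (m i))

module Submission where

-- In characteristic p, p divides (p ^ s C j) for 0 < j < p ^ s, so Pascal's rule gives
-- binom (n + p ^ s) j = binom n j for j < p ^ s: each binom (-, j) with j ≤ k < D is
-- D-periodic. Unfolding the recursion, Λ(k, m) is a sum of products of such binomials, since
-- the summands with j > k have a negative first argument and vanish; so Λ(k, m) only depends
-- on the residues of the m_i mod D. Finally m⁺ ≡ m (mod D), so replacing m_i by m_i + D does
-- not change m_i⁺ mod D.

open import Data.Nat using (ℕ; suc; NonZero)

open import Algebra.Bundles using (CommutativeRing)
import Algebra.Bundles
open import Defs

module BinomialDivisibility where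
  open import Data.Nat
  open import Data.Nat.Properties
  open import Data.Nat.Combinatorics using (_C_; nC1≡n; nCk+nC[k+1]≡[n+1]C[k+1])
  open import Data.Nat.Divisibility
  open import Data.Nat.Primality using (Prime; euclidsLemma; prime⇒nonZero)
  open import Data.Nat.Tactic.RingSolver using (solve-∀)
  open import Data.Sum using (_⊎_; inj₁; inj₂; [_,_])
  open import Function using (id)
  open import Relation.Nullary using (contradiction)
  open import Relation.Binary.PropositionalEquality
  open ≡-Reasoning

  [1+k]*[1+n]C[1+k]≡[1+n]*nCk : ∀ n k → suc k * (suc n C suc k) ≡ suc n * (n C k)
  [1+k]*[1+n]C[1+k]≡[1+n]*nCk zero    zero    = refl
  [1+k]*[1+n]C[1+k]≡[1+n]*nCk zero    (suc k) = *-zeroʳ (suc (suc k))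
  [1+k]*[1+n]C[1+k]≡[1+n]*nCk (suc n) zero    =
    trans (*-identityˡ _) (trans (nC1≡n (suc (suc n))) (sym (*-identityʳ _)))
  [1+k]*[1+n]C[1+k]≡[1+n]*nCk (suc n) (suc k) = begin
    suc (suc k) * (suc (suc n) C suc (suc k))
      ≡⟨ cong (suc (suc k) *_) (nCk+nC[k+1]≡[n+1]C[k+1] (suc n) (suc k)) ⟨
    suc (suc k) * (A + B)
      ≡⟨ split k A B ⟩
    suc k * A + A + suc (suc k) * B
      ≡⟨ cong₂ (λ u v → u + A + v) ([1+k]*[1+n]C[1+k]≡[1+n]*nCk n k)
                                    ([1+k]*[1+n]C[1+k]≡[1+n]*nCk n (suc k)) ⟩
    suc n * (n C k) + A + suc n * (n C suc k)
      ≡⟨ merge n (n C k) (n C suc k) A ⟩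
    suc n * (n C k + n C suc k) + A
      ≡⟨ cong (λ u → suc n * u + A) (nCk+nC[k+1]≡[n+1]C[k+1] n k) ⟩
    suc n * A + A
      ≡⟨ +-comm (suc n * A) A ⟩
    suc (suc n) * A ∎
    where
    A = suc n C suc k
    B = suc n C suc (suc k)
    split : ∀ k A B → suc (suc k) * (A + B) ≡ suc k * A + A + suc (suc k) * B
    split = solve-∀
    merge : ∀ n c d A → suc n * c + A + suc n * d ≡ suc n * (c + d) + A
    merge = solve-∀

  n∣[1+k]*nC[1+k] : ∀ n k → n ∣ suc k * (n C suc k)
  n∣[1+k]*nC[1+k] zero    k = subst (0 ∣_) (sym (*-zeroʳ (suc k))) ∣-refl
  n∣[1+k]*nC[1+k] (suc n) k =
    divides (n C k) (trans ([1+k]*[1+n]C[1+k]≡[1+n]*nCk n k) (*-comm (suc n) (n C k)))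

  p^s∣m*n⇒p∣n⊎p^s∣m : ∀ {p} → Prime p → ∀ s {m n} → p ^ s ∣ m * n → p ∣ n ⊎ p ^ s ∣ m
  p^s∣m*n⇒p∣n⊎p^s∣m pp zero    _ = inj₂ (1∣ _)
  p^s∣m*n⇒p∣n⊎p^s∣m {p} pp (suc s) {m} {n} p^[1+s]∣m*n
    with euclidsLemma m n pp (∣-trans (m∣m*n (p ^ s)) p^[1+s]∣m*n)
  ... | inj₂ p∣n = inj₁ p∣n
  ... | inj₁ (divides q refl) =
    [ inj₁ , (λ p^s∣q → inj₂ (subst (_∣ q * p) (*-comm (p ^ s) p) (*-monoˡ-∣ p p^s∣q))) ]
      (p^s∣m*n⇒p∣n⊎p^s∣m pp s {q} p^s∣q*n)
    where
    instance _ = prime⇒nonZero pp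
    p^s∣q*n : p ^ s ∣ q * n
    p^s∣q*n = *-cancelˡ-∣ p (subst (p * p ^ s ∣_) (reassoc q p n) p^[1+s]∣m*n)
      where
      reassoc : ∀ q p n → q * p * n ≡ p * (q * n)
      reassoc = solve-∀

  p∣[p^s]C[1+j] : ∀ {p} → Prime p → ∀ s j → suc j < p ^ s → p ∣ p ^ s C suc j
  p∣[p^s]C[1+j] {p} pp s j 1+j<p^s =
    [ id , (λ p^s∣1+j → contradiction (∣⇒≤ p^s∣1+j) (<⇒≱ 1+j<p^s)) ]
      (p^s∣m*n⇒p∣n⊎p^s∣m pp s (n∣[1+k]*nC[1+k] (p ^ s) j))

module ΛProperties {c ℓ} (R : CommutativeRing c ℓ) where
  open import Data.Nat as ℕ using (zero; suc; _<_; _≤_; z≤n; s≤s)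
  import Data.Nat.Properties as ℕ
  import Data.Nat.DivMod as ℕ
  open import Data.Nat.Combinatorics using (_C_; nCk+nC[k+1]≡[n+1]C[k+1])
  open import Data.Nat.Combinatorics.Specification using (k>n⇒nCk≡0)
  open import Data.Nat.Divisibility using (_∣_; divides)
  open import Data.Nat.Primality using (Prime)
  open import Data.Integer as ℤ using (+_; -[1+_]; +<+; -<+)
  import Data.Integer.Properties as ℤ
  open import Data.Fin as Fin using (Fin; fromℕ; inject₁)
  open import Relation.Nullary using (yes; no)
  import Relation.Binary.PropositionalEquality as ≡
  open ≡ using (_≡_)
  open CommutativeRing R
  open import Algebra.Definitions.RawSemiring (Algebra.Bundles.Semiring.rawSemiring semiring) using (_×_; _^_)
  open import Algebra.Properties.Semiring.Mult semiring using (×1-homo-*; ×-homo-+)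
  open import Relation.Binary.Reasoning.Setoid setoid
  open BinomialDivisibility using (p∣[p^s]C[1+j])

  binom-pascal : ∀ n j → binom R (suc n) (suc j) ≈ binom R n j + binom R n (suc j)
  binom-pascal n j = begin
    (suc n C suc j) × 1#              ≡⟨ ≡.cong (_× 1#) (nCk+nC[k+1]≡[n+1]C[k+1] n j) ⟨
    (n C j ℕ.+ n C suc j) × 1#        ≈⟨ ×-homo-+ 1# (n C j) (n C suc j) ⟩
    binom R n j + binom R n (suc j)   ∎

  binom-vanishes : ∀ {n j} → n < j → binom R n j ≈ 0#
  binom-vanishes n<j = reflexive (≡.cong (_× 1#) (k>n⇒nCk≡0 n<j))

  module _ {p} (pp : Prime p) (p×1≈0 : p × 1# ≈ 0#) where

    p∣n⇒n×1≈0 : ∀ {n} → p ∣ n → n × 1# ≈ 0#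
    p∣n⇒n×1≈0 (divides q ≡.refl) = trans (×1-homo-* q p) (trans (*-congˡ p×1≈0) (zeroʳ _))

    binom-+-p^s : ∀ s n j → j < p ℕ.^ s → binom R (n ℕ.+ p ℕ.^ s) j ≈ binom R n j
    binom-+-p^s s zero    zero    _ = refl
    binom-+-p^s s zero    (suc j) j<p^s = p∣n⇒n×1≈0 (p∣[p^s]C[1+j] pp s j j<p^s)
    binom-+-p^s s (suc n) zero    _ = refl
    binom-+-p^s s (suc n) (suc j) j<p^s = begin
      binom R (suc n ℕ.+ p ℕ.^ s) (suc j)                         ≈⟨ binom-pascal _ j ⟩
      binom R (n ℕ.+ p ℕ.^ s) j + binom R (n ℕ.+ p ℕ.^ s) (suc j)
        ≈⟨ +-cong (binom-+-p^s s n j (ℕ.<-trans (ℕ.n<1+n j) j<p^s)) (binom-+-p^s s n (suc j) j<p^s) ⟩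
      binom R n j + binom R n (suc j)                              ≈⟨ binom-pascal n j ⟨
      binom R (suc n) (suc j)                                      ∎

  sumUpTo-cong : ∀ n {f g} → (∀ j → j ≤ n → f j ≈ g j) → sumUpTo R n f ≈ sumUpTo R n g
  sumUpTo-cong zero    f≈g = f≈g 0 z≤n
  sumUpTo-cong (suc n) f≈g =
    +-cong (sumUpTo-cong n (λ j j≤n → f≈g j (ℕ.m≤n⇒m≤1+n j≤n))) (f≈g (suc n) ℕ.≤-refl)

  sumUpTo-zero : ∀ n {f} → (∀ j → f j ≈ 0#) → sumUpTo R n f ≈ 0#
  sumUpTo-zero zero    f≈0 = f≈0 0
  sumUpTo-zero (suc n) f≈0 = trans (+-cong (sumUpTo-zero n f≈0) (f≈0 (suc n))) (+-identityˡ 0#)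

  sumUpTo-+-vanishing : ∀ {n f} → (∀ j → n < j → f j ≈ 0#) → ∀ d → sumUpTo R (d ℕ.+ n) f ≈ sumUpTo R n f
  sumUpTo-+-vanishing f≈0 zero    = refl
  sumUpTo-+-vanishing {n} f≈0 (suc d) =
    trans (+-cong (sumUpTo-+-vanishing f≈0 d) (f≈0 _ (s≤s (ℕ.m≤n+m n d)))) (+-identityʳ _)

  sumUpTo-vanishing : ∀ m n {f} → (∀ j → m < j → f j ≈ 0#) → (∀ j → n < j → f j ≈ 0#) →
                      sumUpTo R m f ≈ sumUpTo R n f
  sumUpTo-vanishing m n {f} f≈0>m f≈0>n = begin
    sumUpTo R m f           ≈⟨ sumUpTo-+-vanishing f≈0>m n ⟨
    sumUpTo R (n ℕ.+ m) f   ≡⟨ ≡.cong (λ d → sumUpTo R d f) (ℕ.+-comm n m) ⟩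
    sumUpTo R (m ℕ.+ n) f   ≈⟨ sumUpTo-+-vanishing f≈0>n m ⟩
    sumUpTo R n f           ∎

  Λ₁-+ : ∀ b t n → Λ₁ R b (+ t) n ≈ b ^ t * binom R n t
  Λ₁-+ b t n with t ℕ.≤? n
  ... | yes _   = refl
  ... | no  t≰n = sym (trans (*-congˡ (binom-vanishes (ℕ.≰⇒> t≰n))) (zeroʳ _))

  Λ-negative : ∀ l a {k} m → k ℤ.< + 0 → Λ R l a k m ≈ 0#
  Λ-negative zero    a { -[1+ _ ]} m _ = refl
  Λ-negative zero    a {+ _}       m (+<+ ())
  Λ-negative (suc l) a {k}         m k<0 = sumUpTo-zero (m (fromℕ (suc l))) λ j →
    trans (*-congˡ (Λ-negative l _ _ (ℤ.≤-<-trans (ℤ.i-j≤i k (+ j)) k<0))) (zeroʳ _)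

  module _ (D : ℕ) .{{_ : ℕ.NonZero D}}
           (binom-+D : ∀ n j → j < D → binom R (n ℕ.+ D) j ≈ binom R n j) where

    binom-+-* : ∀ s n j → j < D → binom R (n ℕ.+ s ℕ.* D) j ≈ binom R n j
    binom-+-* zero    n j j<D = reflexive (≡.cong (λ x → binom R x j) (ℕ.+-identityʳ n))
    binom-+-* (suc s) n j j<D = begin
      binom R (n ℕ.+ suc s ℕ.* D) j     ≡⟨ ≡.cong (λ x → binom R x j) (shift n s) ⟩
      binom R (n ℕ.+ s ℕ.* D ℕ.+ D) j   ≈⟨ binom-+D _ j j<D ⟩
      binom R (n ℕ.+ s ℕ.* D) j         ≈⟨ binom-+-* s n j j<D ⟩
      binom R n j                       ∎
      where
      shift : ∀ n s → n ℕ.+ suc s ℕ.* D ≡ n ℕ.+ s ℕ.* D ℕ.+ D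
      shift n s = ≡.trans (≡.cong (n ℕ.+_) (ℕ.+-comm D (s ℕ.* D))) (≡.sym (ℕ.+-assoc n (s ℕ.* D) D))

    binom-% : ∀ n j → j < D → binom R n j ≈ binom R (n ℕ.% D) j
    binom-% n j j<D = begin
      binom R n j                                    ≡⟨ ≡.cong (λ x → binom R x j) (ℕ.m≡m%n+[m/n]*n n D) ⟩
      binom R (n ℕ.% D ℕ.+ (n ℕ./ D) ℕ.* D) j        ≈⟨ binom-+-* (n ℕ./ D) (n ℕ.% D) j j<D ⟩
      binom R (n ℕ.% D) j                            ∎

    binom-cong-% : ∀ {x y} j → x ℕ.% D ≡ y ℕ.% D → j < D → binom R x j ≈ binom R y j
    binom-cong-% {x} {y} j x≡y j<D = begin
      binom R x j             ≈⟨ binom-% x j j<D ⟩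
      binom R (x ℕ.% D) j     ≡⟨ ≡.cong (λ z → binom R z j) x≡y ⟩
      binom R (y ℕ.% D) j     ≈⟨ binom-% y j j<D ⟨
      binom R y j             ∎

    Λ-cong-% : ∀ l a {m m′} → (∀ i → m i ℕ.% D ≡ m′ i ℕ.% D) →
               ∀ {k} → k ℤ.< + D → Λ R l a k m ≈ Λ R l a k m′
    Λ-cong-% zero a m≡m′ { -[1+ _ ]} _ = refl
    Λ-cong-% zero a {m} {m′} m≡m′ {+ t} (+<+ t<D) = begin
      Λ₁ R b (+ t) (m Fin.zero)        ≈⟨ Λ₁-+ b t _ ⟩
      b ^ t * binom R (m Fin.zero) t   ≈⟨ *-congˡ (binom-cong-% t (m≡m′ Fin.zero) t<D) ⟩
      b ^ t * binom R (m′ Fin.zero) t  ≈⟨ Λ₁-+ b t _ ⟨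
      Λ₁ R b (+ t) (m′ Fin.zero)       ∎
      where b = a Fin.zero
    Λ-cong-% (suc l) a {m} {m′} m≡m′ { -[1+ _ ]} _ =
      trans (Λ-negative (suc l) a m -<+) (sym (Λ-negative (suc l) a m′ -<+))
    Λ-cong-% (suc l) a {m} {m′} m≡m′ {+ t} (+<+ t<D) = begin
      sumUpTo R (m L) (term (m L) m)     ≈⟨ truncate m ⟩
      sumUpTo R t (term (m L) m)         ≈⟨ sumUpTo-cong t (λ j j≤t → term-cong (ℕ.≤-<-trans j≤t t<D)) ⟩
      sumUpTo R t (term (m′ L) m′)       ≈⟨ truncate m′ ⟨
      sumUpTo R (m′ L) (term (m′ L) m′)  ∎
      where
      L : Fin (suc (suc l))
      L = fromℕ (suc l)

      term : ℕ → (Fin (suc (suc l)) → ℕ) → ℕ → Carrier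
      term x μ j =
        binom R x j * (a L ^ j) * Λ R l (λ i → a (inject₁ i)) (+ t ℤ.- + j) (λ i → μ (inject₁ i))

      term-vanishes-beyond : ∀ {x} μ j → x < j → term x μ j ≈ 0#
      term-vanishes-beyond μ _ x<j =
        trans (*-congʳ (trans (*-congʳ (binom-vanishes x<j)) (zeroˡ _))) (zeroˡ _)

      term-vanishes-beyond-t : ∀ {x} μ j → t < j → term x μ j ≈ 0#
      term-vanishes-beyond-t μ j t<j = trans (*-congˡ (Λ-negative l _ _ t-j<0)) (zeroʳ _)
        where
        t-j<0 : + t ℤ.- + j ℤ.< + 0
        t-j<0 = ≡.subst (+ t ℤ.- + j ℤ.<_) (ℤ.+-inverseʳ (+ j)) (ℤ.+-monoˡ-< (ℤ.- + j) (+<+ t<j))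

      truncate : ∀ μ → sumUpTo R (μ L) (term (μ L) μ) ≈ sumUpTo R t (term (μ L) μ)
      truncate μ = sumUpTo-vanishing (μ L) t (term-vanishes-beyond μ) (term-vanishes-beyond-t μ)

      term-cong : ∀ {j} → j < D → term (m L) m j ≈ term (m′ L) m′ j
      term-cong {j} j<D = *-cong (*-congʳ (binom-cong-% j (m≡m′ L) j<D))
        (Λ-cong-% l _ (λ i → m≡m′ (inject₁ i)) (ℤ.≤-<-trans (ℤ.i-j≤i (+ t) (+ j)) (+<+ t<D)))

module PlusPart (D : ℕ) .{{_ : NonZero D}} where
  open import Data.Integer using (+_; -[1+_]; _+_; _-_; _*_; -_; _/ℕ_; _≤_; 0ℤ; 1ℤ)
  import Data.Integer.Properties as ℤ
  open import Data.Integer.DivMod using (n<s[n/ℕd]*d)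
  open import Data.Integer.Tactic.RingSolver using (solve-∀)
  import Data.Nat as ℕ
  import Data.Nat.DivMod as ℕ
  open import Data.Product using (∃; _,_)
  open import Relation.Binary.PropositionalEquality
  open ≡-Reasoning

  0≤x+[[-x]/D+1]*D : ∀ x → 0ℤ ≤ x + ((- x) /ℕ D + 1ℤ) * + D
  0≤x+[[-x]/D+1]*D x =
    subst (0ℤ ≤_) (rearrange x ((- x) /ℕ D) (+ D)) (ℤ.i≤j⇒0≤j-i (ℤ.<⇒≤ (n<s[n/ℕd]*d (- x) D)))
    where
    rearrange : ∀ x q d → (1ℤ + q) * d - (- x) ≡ x + (q + 1ℤ) * d
    rearrange = solve-∀

  plusPart-≡ : ∀ x → ∃ λ t → + plusPart D x ≡ x + t * + D
  plusPart-≡ (+ suc n) = 0ℤ , sym (ℤ.+-identityʳ (+ suc n))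
  plusPart-≡ x@(+ 0)      = (- x) /ℕ D + 1ℤ , ℤ.0≤i⇒+∣i∣≡i (0≤x+[[-x]/D+1]*D x)
  plusPart-≡ x@(-[1+ _ ]) = (- x) /ℕ D + 1ℤ , ℤ.0≤i⇒+∣i∣≡i (0≤x+[[-x]/D+1]*D x)

  x≡y+tD⇒x%D≡y%D : ∀ {x y} t → + x ≡ + y + t * + D → x ℕ.% D ≡ y ℕ.% D
  x≡y+tD⇒x%D≡y%D {x} {y} (+ s) x≡y+sD = begin
    x ℕ.% D                   ≡⟨ cong (ℕ._% D) (ℤ.+-injective (trans x≡y+sD (sym (pos-+-* y s)))) ⟩
    (y ℕ.+ s ℕ.* D) ℕ.% D     ≡⟨ ℕ.[m+kn]%n≡m%n y s D ⟩
    y ℕ.% D                   ∎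
    where
    pos-+-* : ∀ y s → + (y ℕ.+ s ℕ.* D) ≡ + y + + s * + D
    pos-+-* y s = trans (ℤ.pos-+ y (s ℕ.* D)) (cong (_+_ (+ y)) (ℤ.pos-* s D))
  x≡y+tD⇒x%D≡y%D {x} {y} t@(-[1+ _ ]) x≡y+tD =
    sym (x≡y+tD⇒x%D≡y%D (- t) (trans (cancel (+ y) t (+ D)) (cong (_+ - t * + D) (sym x≡y+tD))))
    where
    cancel : ∀ y t d → y ≡ (y + t * d) + (- t) * d
    cancel = solve-∀

  plusPart-+D-% : ∀ x → plusPart D (x + + D) ℕ.% D ≡ plusPart D x ℕ.% D
  plusPart-+D-% x with plusPart-≡ (x + + D) | plusPart-≡ x
  ... | t′ , e′ | t , e = x≡y+tD⇒x%D≡y%D (t′ - t + 1ℤ) (begin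
    + plusPart D (x + + D)                    ≡⟨ e′ ⟩
    x + + D + t′ * + D                         ≡⟨ regroup x (+ D) t t′ ⟩
    (x + t * + D) + (t′ - t + 1ℤ) * + D        ≡⟨ cong (_+ (t′ - t + 1ℤ) * + D) e ⟨
    + plusPart D x + (t′ - t + 1ℤ) * + D       ∎)
    where
    regroup : ∀ x d t t′ → x + d + t′ * d ≡ (x + t * d) + (t′ - t + 1ℤ) * d
    regroup = solve-∀

open import Data.Nat using (ℕ; suc; _^_; _≤_; _<_; NonZero)
open import Data.Nat.Primality using (Prime)
open import Data.Integer using (ℤ; +_; _+_)
open import Data.Fin using (Fin)
open import Data.Vec.Functional using (updateAt)
open import Relation.Binary.PropositionalEquality using (_≡_)

open import Data.Nat using (_%_)
open import Data.Integer using (+<+)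
open import Data.Fin using (_≟_)
open import Data.Vec.Functional.Properties using (updateAt-updates; updateAt-minimal)
open import Relation.Binary.PropositionalEquality using (refl; cong; trans)
open import Relation.Nullary using (yes; no)
open ΛProperties using (binom-+-p^s; Λ-cong-%)
open PlusPart using (plusPart-+D-%)

lemma4p10 : ∀ {c ℓ} (F : Field c ℓ) (p : ℕ) → Prime p
    → Field._≈_ F (Field._×_ F p (Field.1# F)) (Field.0# F)
    → (l : ℕ) (a : Fin (suc l) → Field.Carrier F) (k : ℕ) → 0 < k
    → (e : ℕ) → p ^ e ≤ k → k < p ^ suc e
    → (D : ℕ) → .{{_ : NonZero D}} → D ≡ p ^ suc e
    → (i : Fin (suc l)) (m : Fin (suc l) → ℤ)
    → Field._≈_ F
        (Λp (Field.commutativeRing F) D l a (+ k) (updateAt m i (λ x → x + + D)))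
        (Λp (Field.commutativeRing F) D l a (+ k) m)
lemma4p10 F p pp p×1≈0 l a k _ e _ k<D D refl i m =
  Λ-cong-% R D (binom-+-p^s R pp p×1≈0 (suc e)) l a shifted≡ (+<+ k<D)
  where
  R = Field.commutativeRing F
  shifted≡ : ∀ j → plusPart D (updateAt m i (λ x → x + + D) j) % D ≡ plusPart D (m j) % D
  shifted≡ j with j ≟ i
  ... | yes refl = trans (cong (λ x → plusPart D x % D) (updateAt-updates j m)) (plusPart-+D-% D (m j))
  ... | no  j≢i  = cong (λ x → plusPart D x % D) (updateAt-minimal j i m j≢i)
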